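{- Every complete graph is self-isolating.
   Context: All graphs are finite and simple; $\chi$, $\omega$ denote chromatic number and clique number, and for $A\subseteq V(G)$, $\chi(A)=\chi(G[A])$, $\omega(A)=\omega(G[A])$. A graph $G$ contains $H$ if some induced subgraph of $G$ is isomorphic to $H$; such an induced subgraph is a copy of $H$; $G$ is $H$-free if it does not contain $H$. Two disjoint vertex sets are anticomplete if there are no edges between them. A function $\phi:\mathbb{N}\to\mathbb{N}$ is non-decreasing if $\phi(x)\le\phi(y)$ whenever $x\le y$. A graph $H$ is self-isolating if for every non-decreasing polynomial $\psi:\mathbb{N}\to\mathbb{N}$ there is a polynomial $\phi:\mathbb{N}\to\mathbb{N}$ such that for every graph $G$ with $\chi(G)>\phi(\omega(G))$ there exists $A\subseteq V(G)$ with $\chi(A)>\psi(\omega(A))$ such that either $G[A]$ is $H$-free, or $G$ contains a copy $H'$ of $H$ with $V(H')$ disjoint from and anticomplete to $A$. -}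

module Defs where

open import Data.Nat using (ℕ; zero; suc; _≤_; _<_)
open import Data.Integer using (ℤ; +_) renaming (_+_ to _+ℤ_; _*_ to _*ℤ_)
open import Data.List using (List; foldr)
open import Data.Bool using (Bool; true; false; not)
open import Data.Fin using (Fin; _≟_)
open import Data.Fin.Subset using (Subset; _∈_; _∉_; ⊤)
open import Data.Product using (Σ; ∃; _×_; _,_)
open import Data.Sum using (_⊎_)
open import Relation.Nullary using (¬_; yes; no)
open import Relation.Nullary.Decidable using (⌊_⌋)
open import Relation.Binary.PropositionalEquality using (_≡_; _≢_; refl; sym)

record Graph : Set where
  field
    size   : ℕ
    adj    : Fin size → Fin size → Bool
    adj-sym    : ∀ u v → adj u v ≡ adj v u
    adj-irrefl : ∀ v → adj v v ≡ false
open Graph public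

private
  kadj : ∀ {t} → Fin t → Fin t → Bool
  kadj u v = not ⌊ u ≟ v ⌋

  ksym : ∀ {t} (u v : Fin t) → kadj u v ≡ kadj v u
  ksym u v with u ≟ v | v ≟ u
  ... | yes _ | yes _ = refl
  ... | no _  | no _  = refl
  ... | yes p | no q  with q (sym p)
  ... | ()
  ksym u v | no q | yes p with q (sym p)
  ... | ()

  kirr : ∀ {t} (v : Fin t) → kadj v v ≡ false
  kirr v with v ≟ v
  ... | yes _ = refl
  ... | no q with q refl
  ... | ()

K : ℕ → Graph
K t = record { size = t ; adj = kadj ; adj-sym = ksym ; adj-irrefl = kirr }

Injective : ∀ {m n} → (Fin m → Fin n) → Set
Injective f = ∀ i j → f i ≡ f j → i ≡ j

-- An induced copy of H in G whose vertex set lies inside A ⊆ V(G):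
-- an injective map V(H) → A preserving adjacency and non-adjacency.
-- (G[A] contains H iff such a copy exists.)
record CopyIn (H G : Graph) (A : Subset (size G)) : Set where
  field
    emb     : Fin (size H) → Fin (size G)
    emb-inj : Injective emb
    emb-in  : ∀ v → emb v ∈ A
    emb-adj : ∀ u v → adj G (emb u) (emb v) ≡ adj H u v

Copy : (H G : Graph) → Set
Copy H G = Σ (Fin (size H) → Fin (size G)) λ f →
  Injective f × (∀ u v → adj G (f u) (f v) ≡ adj H u v)

FreeOn : (H G : Graph) → Subset (size G) → Set
FreeOn H G A = ¬ CopyIn H G A

AnticompleteCopy : (H G : Graph) → Subset (size G) → Set
AnticompleteCopy H G A = Σ (Copy H G) λ { (f , _) →
  (∀ v → f v ∉ A) × (∀ v u → u ∈ A → adj G (f v) u ≡ false) }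

Colourable : (G : Graph) → Subset (size G) → ℕ → Set
Colourable G A k = Σ ((v : Fin (size G)) → v ∈ A → Fin k) λ c →
  ∀ u v (u∈ : u ∈ A) (v∈ : v ∈ A) → adj G u v ≡ true → c u u∈ ≢ c v v∈

HasClique : (G : Graph) → Subset (size G) → ℕ → Set
HasClique G A w = Σ (Fin w → Fin (size G)) λ f →
  Injective f × (∀ i → f i ∈ A) × (∀ i j → i ≢ j → adj G (f i) (f j) ≡ true)

IsCliqueNumber : (G : Graph) → Subset (size G) → ℕ → Set
IsCliqueNumber G A w = HasClique G A w × (∀ m → HasClique G A m → m ≤ w)

-- χ(A) > f(ω(A))   (χ(A) > k  iff  G[A] is not k-colourable)
ChiExceeds : (G : Graph) → Subset (size G) → (ℕ → ℕ) → Set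
ChiExceeds G A f = ∀ w → IsCliqueNumber G A w → ¬ Colourable G A (f w)

NonDecreasing : (ℕ → ℕ) → Set
NonDecreasing f = ∀ x y → x ≤ y → f x ≤ f y

evalℤ : List ℤ → ℤ → ℤ
evalℤ cs x = foldr (λ c acc → c +ℤ (x *ℤ acc)) (+ 0) cs

-- f : ℕ → ℕ is a polynomial (with rational coefficients, written with a
-- common positive denominator d+1 and integer numerators).
IsPolynomial : (ℕ → ℕ) → Set
IsPolynomial f = Σ ℕ λ d → Σ (List ℤ) λ cs →
  ∀ x → + (suc d) *ℤ + (f x) ≡ evalℤ cs (+ x)

SelfIsolating : Graph → Set
SelfIsolating H =
  ∀ (ψ : ℕ → ℕ) → NonDecreasing ψ → IsPolynomial ψ →
  Σ (ℕ → ℕ) λ φ → IsPolynomial φ ×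
    (∀ (G : Graph) → ChiExceeds G ⊤ φ →
      Σ (Subset (size G)) λ A → ChiExceeds G A ψ ×
        (FreeOn H G A ⊎ AnticompleteCopy H G A))

module Submission where

-- Let Q be a maximum clique of G, of size ω, and t = s + 1.  If ω < t then G
-- itself is K_t-free.  Otherwise every vertex x outside Q either has t
-- non-neighbours Q ∘ g in Q (g : Fin t → Fin ω injective), and then lies in the
-- set of vertices anticomplete to the copy Q ∘ g of K_t; or all its
-- non-neighbours in Q are among s vertices Q ∘ g (g : Fin s → Fin ω), and then x
-- is complete to the rest of Q.  The latter set is K_t-free, since a K_t inside
-- it could replace Q ∘ g in Q and give a clique of size ω + 1.  So either one of
-- these ω^t + ω^s candidate sets A has χ(A) > ψ(ω(A)), or, colouring Q with ω
-- colours and each candidate with ψ(ω) colours (ω(A) ≤ ω and ψ is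
-- non-decreasing), χ(G) ≤ ω + (ω^t + ω^s) ψ(ω); hence
-- φ(x) = ψ(x) + x + (x^t + x^s) ψ(x) works.

open import Data.Bool using (true; false; not)
open import Data.Bool.Properties using (¬-not) renaming (_≟_ to _≟ᵇ_)
open import Data.Empty using (⊥-elim)
open import Data.Fin as Fin using (Fin; _≟_; finToFun; funToFin)
open import Data.Fin.Properties
  using ( any?; all?; ¬Fin0; finToFun-funToFin; injective⇒≤; inject≤-injective; combine-injective
        ; splitAt-join; fromℕ≢inject₁; inject₁-injective )
open import Data.Fin.Subset using (Subset; _∈_; _⊆_; _∪_; ⊤; ⁅_⁆; Empty)
open import Data.Fin.Subset.Properties using (_∈?_; ∈⊤; x∈p∪q⁺; x∈p∪q⁻; x∈⁅x⁆; x∈⁅y⁆⇒x≡y)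
open import Data.Integer using (ℤ; +_) renaming (_+_ to _+ℤ_; _*_ to _*ℤ_)
open import Data.Integer.Properties using (pos-+; pos-*; +-identityˡ; +-identityʳ; *-zeroˡ; *-zeroʳ)
open import Data.Integer.Tactic.RingSolver using (solve-∀)
open import Data.List using (List; []; _∷_; map; filter; allFin)
open import Data.List.Membership.Propositional using () renaming (_∈_ to _∈ₗ_)
import Data.List.Membership.DecPropositional as DecMembership
open import Data.List.Membership.Propositional.Properties using (∈-filter⁺; ∈-filter⁻; ∈-allFin)
open import Data.List.Relation.Unary.Any using (here; there)
open import Data.Nat as ℕ using (ℕ; zero; suc; _+_; _*_; _^_; _≤_)
open import Data.Nat.Properties as ℕ using ()
open import Data.Product using (Σ; ∃; _×_; _,_; proj₁; proj₂)
open import Data.Sum as Sum using (_⊎_; inj₁; inj₂; [_,_]′)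
open import Data.Sum.Properties using (inj₁-injective; inj₂-injective)
open import Data.Unit using () renaming (⊤ to Unit)
open import Data.Vec using (tabulate)
import Data.Vec.Functional as Vector
open import Data.Vec.Properties using (lookup∘tabulate; []=⇒lookup; lookup⇒[]=)
open import Function using (_∘_; case_of_)
open import Level using (0ℓ)
open import Relation.Binary.PropositionalEquality
open import Relation.Nullary using (¬_; Dec; yes; no; does; contradiction)
open import Relation.Nullary.Decidable using (⌊_⌋; map′; ¬?; _×-dec_; _→-dec_; dec-true)
open import Relation.Unary using (Pred; Decidable)

open import Defs

-- Polynomials

infixl 6 _+ᴾ_
infixl 7 _*ᴾ_

_+ᴾ_ : List ℤ → List ℤ → List ℤ
[] +ᴾ bs = bs
(a ∷ as) +ᴾ [] = a ∷ as
(a ∷ as) +ᴾ (b ∷ bs) = (a +ℤ b) ∷ (as +ᴾ bs)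

_*ᴾ_ : List ℤ → List ℤ → List ℤ
[] *ᴾ bs = []
(a ∷ as) *ᴾ bs = map (a *ℤ_) bs +ᴾ (+ 0 ∷ as *ᴾ bs)

evalℤ-+ᴾ : ∀ as bs x → evalℤ (as +ᴾ bs) x ≡ evalℤ as x +ℤ evalℤ bs x
evalℤ-+ᴾ [] bs x = sym (+-identityˡ _)
evalℤ-+ᴾ (a ∷ as) [] x = sym (+-identityʳ _)
evalℤ-+ᴾ (a ∷ as) (b ∷ bs) x = begin
  a +ℤ b +ℤ x *ℤ evalℤ (as +ᴾ bs) x              ≡⟨ cong (λ e → a +ℤ b +ℤ x *ℤ e) (evalℤ-+ᴾ as bs x) ⟩
  a +ℤ b +ℤ x *ℤ (evalℤ as x +ℤ evalℤ bs x)      ≡⟨ regroup a b x (evalℤ as x) (evalℤ bs x) ⟩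
  a +ℤ x *ℤ evalℤ as x +ℤ (b +ℤ x *ℤ evalℤ bs x) ∎
  where
  open ≡-Reasoning
  regroup : ∀ a b x p q → a +ℤ b +ℤ x *ℤ (p +ℤ q) ≡ a +ℤ x *ℤ p +ℤ (b +ℤ x *ℤ q)
  regroup = solve-∀

evalℤ-map-* : ∀ c bs x → evalℤ (map (c *ℤ_) bs) x ≡ c *ℤ evalℤ bs x
evalℤ-map-* c [] x = sym (*-zeroʳ c)
evalℤ-map-* c (b ∷ bs) x = begin
  c *ℤ b +ℤ x *ℤ evalℤ (map (c *ℤ_) bs) x ≡⟨ cong (λ e → c *ℤ b +ℤ x *ℤ e) (evalℤ-map-* c bs x) ⟩
  c *ℤ b +ℤ x *ℤ (c *ℤ evalℤ bs x)        ≡⟨ factor c b x (evalℤ bs x) ⟩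
  c *ℤ (b +ℤ x *ℤ evalℤ bs x)             ∎
  where
  open ≡-Reasoning
  factor : ∀ c b x p → c *ℤ b +ℤ x *ℤ (c *ℤ p) ≡ c *ℤ (b +ℤ x *ℤ p)
  factor = solve-∀

evalℤ-*ᴾ : ∀ as bs x → evalℤ (as *ᴾ bs) x ≡ evalℤ as x *ℤ evalℤ bs x
evalℤ-*ᴾ [] bs x = sym (*-zeroˡ (evalℤ bs x))
evalℤ-*ᴾ (a ∷ as) bs x = begin
  evalℤ (map (a *ℤ_) bs +ᴾ (+ 0 ∷ as *ᴾ bs)) x                 ≡⟨ evalℤ-+ᴾ (map (a *ℤ_) bs) _ x ⟩
  evalℤ (map (a *ℤ_) bs) x +ℤ (+ 0 +ℤ x *ℤ evalℤ (as *ᴾ bs) x) ≡⟨ cong₂ (λ l r → l +ℤ (+ 0 +ℤ x *ℤ r))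
                                                                          (evalℤ-map-* a bs x) (evalℤ-*ᴾ as bs x) ⟩
  a *ℤ q +ℤ (+ 0 +ℤ x *ℤ (evalℤ as x *ℤ q))                   ≡⟨ factor a x (evalℤ as x) q ⟩
  (a +ℤ x *ℤ evalℤ as x) *ℤ q                                  ∎
  where
  open ≡-Reasoning
  q : ℤ
  q = evalℤ bs x
  factor : ∀ a x p q → a *ℤ q +ℤ (+ 0 +ℤ x *ℤ (p *ℤ q)) ≡ (a +ℤ x *ℤ p) *ℤ q
  factor = solve-∀

IsPolynomial-const : ∀ c → IsPolynomial (λ _ → c)
IsPolynomial-const c = 0 , + c ∷ [] , λ x → constant (+ c) (+ x)
  where
  constant : ∀ c x → + 1 *ℤ c ≡ c +ℤ x *ℤ + 0
  constant = solve-∀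

IsPolynomial-id : IsPolynomial (λ x → x)
IsPolynomial-id = 0 , + 0 ∷ + 1 ∷ [] , λ x → linear (+ x)
  where
  linear : ∀ x → + 1 *ℤ x ≡ + 0 +ℤ x *ℤ (+ 1 +ℤ x *ℤ + 0)
  linear = solve-∀

-- The common denominator (d₁ + 1)(d₂ + 1) is suc (d₂ + d₁ * suc d₂) by definition.
IsPolynomial-+ : ∀ {f g} → IsPolynomial f → IsPolynomial g → IsPolynomial (λ x → f x + g x)
IsPolynomial-+ {f} {g} (d₁ , cs , f≡) (d₂ , ds , g≡) =
  d₂ + d₁ * suc d₂ , map (D₂ *ℤ_) cs +ᴾ map (D₁ *ℤ_) ds , λ x → begin
    + (suc d₁ * suc d₂) *ℤ + (f x + g x)
      ≡⟨ cong₂ _*ℤ_ (pos-* (suc d₁) (suc d₂)) (pos-+ (f x) (g x)) ⟩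
    D₁ *ℤ D₂ *ℤ (+ f x +ℤ + g x)
      ≡⟨ regroup D₁ D₂ (+ f x) (+ g x) ⟩
    D₂ *ℤ (D₁ *ℤ + f x) +ℤ D₁ *ℤ (D₂ *ℤ + g x)
      ≡⟨ cong₂ (λ p q → D₂ *ℤ p +ℤ D₁ *ℤ q) (f≡ x) (g≡ x) ⟩
    D₂ *ℤ evalℤ cs (+ x) +ℤ D₁ *ℤ evalℤ ds (+ x)
      ≡⟨ sym (cong₂ _+ℤ_ (evalℤ-map-* D₂ cs (+ x)) (evalℤ-map-* D₁ ds (+ x))) ⟩
    evalℤ (map (D₂ *ℤ_) cs) (+ x) +ℤ evalℤ (map (D₁ *ℤ_) ds) (+ x)
      ≡⟨ sym (evalℤ-+ᴾ (map (D₂ *ℤ_) cs) _ (+ x)) ⟩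
    evalℤ (map (D₂ *ℤ_) cs +ᴾ map (D₁ *ℤ_) ds) (+ x) ∎
  where
  open ≡-Reasoning
  D₁ D₂ : ℤ
  D₁ = + suc d₁
  D₂ = + suc d₂
  regroup : ∀ a b p q → a *ℤ b *ℤ (p +ℤ q) ≡ b *ℤ (a *ℤ p) +ℤ a *ℤ (b *ℤ q)
  regroup = solve-∀

IsPolynomial-* : ∀ {f g} → IsPolynomial f → IsPolynomial g → IsPolynomial (λ x → f x * g x)
IsPolynomial-* {f} {g} (d₁ , cs , f≡) (d₂ , ds , g≡) =
  d₂ + d₁ * suc d₂ , cs *ᴾ ds , λ x → begin
    + (suc d₁ * suc d₂) *ℤ + (f x * g x) ≡⟨ cong₂ _*ℤ_ (pos-* (suc d₁) (suc d₂)) (pos-* (f x) (g x)) ⟩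
    D₁ *ℤ D₂ *ℤ (+ f x *ℤ + g x)         ≡⟨ regroup D₁ D₂ (+ f x) (+ g x) ⟩
    (D₁ *ℤ + f x) *ℤ (D₂ *ℤ + g x)       ≡⟨ cong₂ _*ℤ_ (f≡ x) (g≡ x) ⟩
    evalℤ cs (+ x) *ℤ evalℤ ds (+ x)     ≡⟨ sym (evalℤ-*ᴾ cs ds (+ x)) ⟩
    evalℤ (cs *ᴾ ds) (+ x)               ∎
  where
  open ≡-Reasoning
  D₁ D₂ : ℤ
  D₁ = + suc d₁
  D₂ = + suc d₂
  regroup : ∀ a b p q → a *ℤ b *ℤ (p *ℤ q) ≡ (a *ℤ p) *ℤ (b *ℤ q)
  regroup = solve-∀

IsPolynomial-^ : ∀ k → IsPolynomial (λ x → x ^ k)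
IsPolynomial-^ zero = IsPolynomial-const 1
IsPolynomial-^ (suc k) = IsPolynomial-* IsPolynomial-id (IsPolynomial-^ k)

-- Finite search

toSubset : ∀ {n} {P : Pred (Fin n) 0ℓ} → Decidable P → Subset n
toSubset P? = tabulate (λ x → does (P? x))

module _ {n} {P : Pred (Fin n) 0ℓ} (P? : Decidable P) where

  ∈-toSubset⁺ : ∀ {x} → P x → x ∈ toSubset P?
  ∈-toSubset⁺ {x} p = lookup⇒[]= x _ (trans (lookup∘tabulate _ x) (dec-true (P? x) p))

  ∈-toSubset⁻ : ∀ {x} → x ∈ toSubset P? → P x
  ∈-toSubset⁻ {x} x∈ = witness (P? x) (trans (sym (lookup∘tabulate _ x)) ([]=⇒lookup x∈))
    where
    witness : (d : Dec (P x)) → does d ≡ true → P x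
    witness (yes p) _ = p

module _ {N n} (A : Fin N → Subset n) where

  private
    inSome? : Decidable λ v → ∃ λ i → v ∈ A i
    inSome? v = any? λ i → v ∈? A i

  ⋃ᶠ : Subset n
  ⋃ᶠ = toSubset inSome?

  ∈⋃ᶠ⁺ : ∀ {v} i → v ∈ A i → v ∈ ⋃ᶠ
  ∈⋃ᶠ⁺ i v∈Ai = ∈-toSubset⁺ inSome? (i , v∈Ai)

  ∈⋃ᶠ⁻ : ∀ {v} → v ∈ ⋃ᶠ → ∃ λ i → v ∈ A i
  ∈⋃ᶠ⁻ = ∈-toSubset⁻ inSome?

any-function? : ∀ {m n} {P : Pred (Fin m → Fin n) 0ℓ} →
                (∀ {f g} → f ≗ g → P f → P g) → Decidable P → Dec (∃ P)
any-function? resp P? =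
  map′ (λ (k , p) → finToFun k , p)
       (λ (f , p) → funToFin f , resp (sym ∘ finToFun-funToFin f) p)
       (any? (P? ∘ finToFun))

injective? : ∀ {m n} (f : Fin m → Fin n) → Dec (Injective f)
injective? f = all? λ i → all? λ j → f i ≟ f j →-dec i ≟ j

injective-resp : ∀ {m n} {f g : Fin m → Fin n} → f ≗ g → Injective f → Injective g
injective-resp f≗g f-inj i j gi≡gj = f-inj i j (trans (f≗g i) (trans gi≡gj (sym (f≗g j))))

largest : (P : Pred ℕ 0ℓ) → Decidable P → P 0 → ∀ k → (∀ m → P m → m ≤ k) →
          ∃ λ w → P w × (∀ m → P m → m ≤ w)
largest P P? p0 zero bound = 0 , p0 , bound
largest P P? p0 (suc k) bound with P? (suc k)
... | yes p = suc k , p , bound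
... | no ¬p = largest P P? p0 k λ m pm → ℕ.m<1+n⇒m≤n (ℕ.≤∧≢⇒< (bound m pm) λ { refl → ¬p pm })

someLeft-or-allRight : ∀ {N} {A : Set} {B : Fin N → Set} → (∀ i → A ⊎ B i) → A ⊎ (∀ i → B i)
someLeft-or-allRight {zero} _ = inj₂ λ ()
someLeft-or-allRight {suc N} f with f Fin.zero | someLeft-or-allRight (f ∘ Fin.suc)
... | inj₁ a | _ = inj₁ a
... | inj₂ _ | inj₁ a = inj₁ a
... | inj₂ b | inj₂ bs = inj₂ λ { Fin.zero → b ; (Fin.suc i) → bs i }

module _ {n} (default : Fin n) where

  open DecMembership (_≟_ {n}) using () renaming (_∈?_ to _∈ₗ?_)

  distinct-or-covered : ∀ s (L : List (Fin n)) →
    (Σ (Fin (suc s) → Fin n) λ g → Injective g × (∀ j → g j ∈ₗ L)) ⊎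
    (Σ (Fin s → Fin n) λ g → ∀ a → a ∈ₗ L → ∃ λ j → g j ≡ a)
  distinct-or-covered s [] = inj₂ ((λ _ → default) , λ _ ())
  distinct-or-covered s (a ∷ L) with a ∈ₗ? L
  ... | yes a∈L = Sum.map
    (λ (g , g-inj , g∈L) → g , g-inj , there ∘ g∈L)
    (λ (g , g-covers) → g , λ { _ (here refl) → g-covers a a∈L ; b (there b∈L) → g-covers b b∈L })
    (distinct-or-covered s L)
  distinct-or-covered zero (a ∷ L) | no a∉L =
    inj₁ ((λ _ → a) , (λ { Fin.zero Fin.zero _ → refl }) , λ _ → here refl)
  distinct-or-covered (suc s) (a ∷ L) | no a∉L = Sum.map
    (λ (g , g-inj , g∈L) →
       a Vector.∷ g , ∷-injective g-inj g∈L , λ { Fin.zero → here refl ; (Fin.suc j) → there (g∈L j) })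
    (λ (g , g-covers) →
       a Vector.∷ g , λ { _ (here refl) → Fin.zero , refl
                        ; b (there b∈L) → let (j , gj≡b) = g-covers b b∈L in Fin.suc j , gj≡b })
    (distinct-or-covered s L)
    where
    ∷-injective : ∀ {m} {g : Fin m → Fin n} → Injective g → (∀ j → g j ∈ₗ L) → Injective (a Vector.∷ g)
    ∷-injective g-inj g∈L Fin.zero Fin.zero _ = refl
    ∷-injective g-inj g∈L Fin.zero (Fin.suc j) a≡gj = contradiction (subst (_∈ₗ L) (sym a≡gj) (g∈L j)) a∉L
    ∷-injective g-inj g∈L (Fin.suc i) Fin.zero gi≡a = contradiction (subst (_∈ₗ L) gi≡a (g∈L i)) a∉L
    ∷-injective g-inj g∈L (Fin.suc i) (Fin.suc j) gi≡gj = cong Fin.suc (g-inj i j gi≡gj)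

-- Cliques and colourings

adj-K : ∀ {t} {u v : Fin t} → u ≢ v → adj (K t) u v ≡ true
adj-K {u = u} {v} u≢v = distinct (u ≟ v)
  where
  distinct : (d : Dec (u ≡ v)) → not ⌊ d ⌋ ≡ true
  distinct (yes u≡v) = contradiction u≡v u≢v
  distinct (no _) = refl

module _ (G : Graph) where

  IsClique : ∀ {w} → (Fin w → Fin (size G)) → Set
  IsClique f = ∀ i j → i ≢ j → adj G (f i) (f j) ≡ true

  clique-injective : ∀ {w} {f : Fin w → Fin (size G)} → IsClique f → Injective f
  clique-injective {f = f} f-clique i j fi≡fj with i ≟ j
  ... | yes i≡j = i≡j
  ... | no i≢j with trans (sym (f-clique i j i≢j)) (trans (cong (adj G (f i)) (sym fi≡fj)) (adj-irrefl G (f i)))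
  ... | ()

  clique⇒copyK : ∀ {t} (f : Fin t → Fin (size G)) → IsClique f → Copy (K t) G
  clique⇒copyK {t} f f-clique = f , clique-injective f-clique , adj-f
    where
    adj-f : ∀ u v → adj G (f u) (f v) ≡ adj (K t) u v
    adj-f u v = case u ≟ v of λ where
      (yes refl) → trans (adj-irrefl G (f u)) (sym (adj-irrefl (K t) u))
      (no u≢v) → trans (f-clique u v u≢v) (sym (adj-K u≢v))

  copyK⇒clique : ∀ {t A} → CopyIn (K t) G A → HasClique G A t
  copyK⇒clique c = emb , emb-inj , emb-in , λ i j i≢j → trans (emb-adj i j) (adj-K i≢j)
    where open CopyIn c

  hasClique-⊆ : ∀ {A B w} → A ⊆ B → HasClique G A w → HasClique G B w
  hasClique-⊆ A⊆B (f , f-inj , f∈A , f-clique) = f , f-inj , A⊆B ∘ f∈A , f-clique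

  hasClique? : ∀ A w → Dec (HasClique G A w)
  hasClique? A w = any-function? transport λ f →
    injective? f ×-dec all? (λ i → f i ∈? A) ×-dec
    all? λ i → all? λ j → ¬? (i ≟ j) →-dec adj G (f i) (f j) ≟ᵇ true
    where
    transport : ∀ {f g} → f ≗ g → Injective f × (∀ i → f i ∈ A) × IsClique f →
                Injective g × (∀ i → g i ∈ A) × IsClique g
    transport f≗g (f-inj , f∈A , f-clique) =
      injective-resp f≗g f-inj ,
      (λ i → subst (_∈ A) (f≗g i) (f∈A i)) ,
      (λ i j i≢j → subst₂ (λ a b → adj G a b ≡ true) (f≗g i) (f≗g j) (f-clique i j i≢j))

  cliqueNumber : ∀ A → ∃ (IsCliqueNumber G A)
  cliqueNumber A = largest (HasClique G A) (hasClique? A) empty (size G)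
    λ m (f , f-inj , _) → injective⇒≤ λ {i} {j} → f-inj i j
    where
    empty : HasClique G A 0
    empty = (λ ()) , (λ ()) , (λ ()) , λ ()

  cliqueNumber-unique : ∀ {A w w′} → IsCliqueNumber G A w → IsCliqueNumber G A w′ → w ≡ w′
  cliqueNumber-unique (w-clique , w-max) (w′-clique , w′-max) =
    ℕ.≤-antisym (w′-max _ w-clique) (w-max _ w′-clique)

  colourable-mono : ∀ {A k k′} → k ≤ k′ → Colourable G A k → Colourable G A k′
  colourable-mono k≤k′ (c , c-proper) =
    (λ v v∈ → Fin.inject≤ (c v v∈) k≤k′) ,
    λ u v u∈ v∈ uv → c-proper u v u∈ v∈ uv ∘ inject≤-injective k≤k′ k≤k′ _ _

  chiExceeds-mono : ∀ {A f g} → (∀ w → f w ≤ g w) → ChiExceeds G A g → ChiExceeds G A f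
  chiExceeds-mono f≤g A-exceeds w w-number = A-exceeds w w-number ∘ colourable-mono (f≤g w)

  colourable-∅ : ∀ {A k} → Empty A → Colourable G A k
  colourable-∅ A-empty = (λ v v∈ → ⊥-elim (A-empty (v , v∈))) , λ u _ u∈ _ _ → ⊥-elim (A-empty (u , u∈))

  colourable-⊆ : ∀ {A B k} → A ⊆ B → Colourable G B k → Colourable G A k
  colourable-⊆ A⊆B (c , c-proper) =
    (λ v v∈ → c v (A⊆B v∈)) , λ u v u∈ v∈ → c-proper u v (A⊆B u∈) (A⊆B v∈)

  colourable-⁅⁆ : ∀ x → Colourable G ⁅ x ⁆ 1
  colourable-⁅⁆ x = (λ _ _ → Fin.zero) , loopless
    where
    loopless : ∀ u v → u ∈ ⁅ x ⁆ → v ∈ ⁅ x ⁆ → adj G u v ≡ true → Fin.zero ≢ Fin.zero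
    loopless u v u∈ v∈ uv _ with x∈⁅y⁆⇒x≡y x u∈ | x∈⁅y⁆⇒x≡y x v∈
    ... | refl | refl with trans (sym uv) (adj-irrefl G u)
    ... | ()

  colourable-∪ : ∀ {A B a b} → Colourable G A a → Colourable G B b → Colourable G (A ∪ B) (a + b)
  colourable-∪ {A} {B} {a} {b} (c , c-proper) (d , d-proper) =
    (λ v v∈ → Fin.join a b (colour v (x∈p∪q⁻ A B v∈))) ,
    λ u v u∈ v∈ uv same → separated u v (x∈p∪q⁻ A B u∈) (x∈p∪q⁻ A B v∈) uv (join-injective same)
    where
    colour : ∀ v → v ∈ A ⊎ v ∈ B → Fin a ⊎ Fin b
    colour v (inj₁ v∈A) = inj₁ (c v v∈A)
    colour v (inj₂ v∈B) = inj₂ (d v v∈B)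

    separated : ∀ u v u∈ v∈ → adj G u v ≡ true → colour u u∈ ≢ colour v v∈
    separated u v (inj₁ u∈A) (inj₁ v∈A) uv = c-proper u v u∈A v∈A uv ∘ inj₁-injective
    separated u v (inj₂ u∈B) (inj₂ v∈B) uv = d-proper u v u∈B v∈B uv ∘ inj₂-injective
    separated u v (inj₁ _) (inj₂ _) uv ()
    separated u v (inj₂ _) (inj₁ _) uv ()

    join-injective : ∀ {x y} → Fin.join a b x ≡ Fin.join a b y → x ≡ y
    join-injective {x} {y} eq =
      trans (sym (splitAt-join a b x)) (trans (cong (Fin.splitAt a) eq) (splitAt-join a b y))

  colourable-⋃ᶠ : ∀ {N P} (A : Fin N → Subset (size G)) → (∀ i → Colourable G (A i) P) →
                  Colourable G (⋃ᶠ A) (N * P)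
  colourable-⋃ᶠ {N} {P} A A-colourable =
    (λ v v∈ → colour v (∈⋃ᶠ⁻ A v∈)) , λ u v u∈ v∈ → separated u v (∈⋃ᶠ⁻ A u∈) (∈⋃ᶠ⁻ A v∈)
    where
    colour : ∀ v → ∃ (λ i → v ∈ A i) → Fin (N * P)
    colour v (i , v∈Ai) = Fin.combine i (proj₁ (A-colourable i) v v∈Ai)

    separated : ∀ u v u∈ v∈ → adj G u v ≡ true → colour u u∈ ≢ colour v v∈
    separated u v (i , u∈Ai) (j , v∈Aj) uv same with combine-injective i _ j _ same
    ... | refl , same-colour = proj₂ (A-colourable i) u v u∈Ai v∈Aj uv same-colour

  -- A colouring of A is only defined on A; for k > 0 it extends to a total map
  -- Fin (size G) → Fin k, and those can be searched.
  colourable? : ∀ A k → Dec (Colourable G A k)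
  colourable? A zero = map′ colourable-∅ (λ (c , _) (v , v∈) → ¬Fin0 (c v v∈)) (¬? (any? λ v → v ∈? A))
  colourable? A (suc k) = map′ restrict extend (any-function? transport λ c →
    all? λ u → all? λ v → u ∈? A →-dec v ∈? A →-dec adj G u v ≟ᵇ true →-dec ¬? (c u ≟ c v))
    where
    ProperOn : (Fin (size G) → Fin (suc k)) → Set
    ProperOn c = ∀ u v → u ∈ A → v ∈ A → adj G u v ≡ true → c u ≢ c v

    transport : ∀ {c d} → c ≗ d → ProperOn c → ProperOn d
    transport c≗d c-proper u v u∈ v∈ uv du≡dv =
      c-proper u v u∈ v∈ uv (trans (c≗d u) (trans du≡dv (sym (c≗d v))))

    restrict : ∃ ProperOn → Colourable G A (suc k)
    restrict (c , c-proper) = (λ v _ → c v) , c-proper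

    extend : Colourable G A (suc k) → ∃ ProperOn
    extend (c , c-proper) = total , total-proper
      where
      total : Fin (size G) → Fin (suc k)
      total v with v ∈? A
      ... | yes v∈ = c v v∈
      ... | no _ = Fin.zero

      total-proper : ProperOn total
      total-proper u v u∈ v∈ uv with u ∈? A | v ∈? A
      ... | yes u∈′ | yes v∈′ = c-proper u v u∈′ v∈′ uv
      ... | no u∉ | _ = contradiction u∈ u∉
      ... | yes _ | no v∉ = contradiction v∈ v∉

  chiExceeds-or-colourable : ∀ {ψ ω} → NonDecreasing ψ → (∀ m → HasClique G ⊤ m → m ≤ ω) →
                             ∀ A → ChiExceeds G A ψ ⊎ Colourable G A (ψ ω)
  chiExceeds-or-colourable {ψ} {ω} ψ-mono ω-max A with cliqueNumber A
  ... | w , w-number with colourable? A (ψ w)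
  ... | yes c = inj₂ (colourable-mono (ψ-mono w ω (ω-max w (hasClique-⊆ (λ _ → ∈⊤) (proj₁ w-number)))) c)
  ... | no ¬c = inj₁ λ w′ w′-number →
    subst (λ z → ¬ Colourable G A (ψ z)) (cliqueNumber-unique w-number w′-number) ¬c

-- The candidate sets around a maximum clique

Isolating : (H G : Graph) → (ℕ → ℕ) → Set
Isolating H G ψ = Σ (Subset (size G)) λ A → ChiExceeds G A ψ × (FreeOn H G A ⊎ AnticompleteCopy H G A)

module MaximumClique (G : Graph) {ω} (ω-number : IsCliqueNumber G ⊤ ω) where

  private
    V : Set
    V = Fin (size G)

  Q : Fin ω → V
  Q = proj₁ (proj₁ ω-number)

  Q-clique : IsClique G Q
  Q-clique = proj₂ (proj₂ (proj₂ (proj₁ ω-number)))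

  ω-max : ∀ m → HasClique G ⊤ m → m ≤ ω
  ω-max = proj₂ ω-number

  -- The conjunct Injective g makes the set empty for non-injective g, so that the
  -- candidates can be indexed by all ω ^ t maps g.
  IsolatedFrom : ∀ {t} → (Fin t → Fin ω) → Pred V 0ℓ
  IsolatedFrom g x = Injective g × (∀ j → x ≢ Q (g j) × adj G x (Q (g j)) ≡ false)

  SeesAllBut : ∀ {s} → (Fin s → Fin ω) → Pred V 0ℓ
  SeesAllBut g x = ∀ i → (∀ j → g j ≢ i) → adj G x (Q i) ≡ true

  IsolatedFrom? : ∀ {t} (g : Fin t → Fin ω) → Decidable (IsolatedFrom g)
  IsolatedFrom? g x = injective? g ×-dec all? λ j → ¬? (x ≟ Q (g j)) ×-dec adj G x (Q (g j)) ≟ᵇ false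

  SeesAllBut? : ∀ {s} (g : Fin s → Fin ω) → Decidable (SeesAllBut g)
  SeesAllBut? g x = all? λ i → all? (λ j → ¬? (g j ≟ i)) →-dec adj G x (Q i) ≟ᵇ true

  isolatedFrom : ∀ {t} → (Fin t → Fin ω) → Subset (size G)
  isolatedFrom g = toSubset (IsolatedFrom? g)

  seesAllBut : ∀ {s} → (Fin s → Fin ω) → Subset (size G)
  seesAllBut g = toSubset (SeesAllBut? g)

  isolatedFrom-resp : ∀ {t} {g h : Fin t → Fin ω} → g ≗ h → ∀ {x} → IsolatedFrom g x → IsolatedFrom h x
  isolatedFrom-resp g≗h (g-inj , g-isolated) =
    injective-resp g≗h g-inj , λ j → subst (λ i → _ ≢ Q i × adj G _ (Q i) ≡ false) (g≗h j) (g-isolated j)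

  seesAllBut-resp : ∀ {s} {g h : Fin s → Fin ω} → g ≗ h → ∀ {x} → SeesAllBut g x → SeesAllBut h x
  seesAllBut-resp g≗h g-sees i h-misses = g-sees i λ j gj≡i → h-misses j (trans (sym (g≗h j)) gj≡i)

  isolatedFrom-copy : ∀ {t} {g : Fin t → Fin ω} → Injective g → AnticompleteCopy (K t) G (isolatedFrom g)
  isolatedFrom-copy {g = g} g-inj =
    clique⇒copyK G (Q ∘ g) (λ i j i≢j → Q-clique (g i) (g j) (i≢j ∘ g-inj i j)) ,
    (λ v Qgv∈ → proj₁ (proj₂ (∈-toSubset⁻ (IsolatedFrom? g) Qgv∈) v) refl) ,
    (λ v u u∈ → trans (adj-sym G _ u) (proj₂ (proj₂ (∈-toSubset⁻ (IsolatedFrom? g) u∈) v)))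

  -- The clique of size ω + 1 consists of C (fromℕ s) and, for each i, of C j
  -- (injected) if i = g j and of Q i otherwise; slot says which of the two.
  module Enlarge {s} (g : Fin s → Fin ω) (C : Fin (suc s) → V)
                 (C-clique : IsClique G C) (C-sees : ∀ u → SeesAllBut g (C u)) where

    Outside : Fin (suc s) ⊎ Fin ω → Set
    Outside (inj₁ _) = Unit
    Outside (inj₂ i) = ∀ j → g j ≢ i

    vertex : Fin (suc s) ⊎ Fin ω → V
    vertex = [ C , Q ]′

    vertex-adjacent : ∀ p q → Outside p → Outside q → p ≢ q → adj G (vertex p) (vertex q) ≡ true
    vertex-adjacent (inj₁ u) (inj₁ v) _ _ p≢q = C-clique u v (p≢q ∘ cong inj₁)
    vertex-adjacent (inj₁ u) (inj₂ i) _ i-out _ = C-sees u i i-out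
    vertex-adjacent (inj₂ i) (inj₁ u) i-out _ _ = trans (adj-sym G (Q i) (C u)) (C-sees u i i-out)
    vertex-adjacent (inj₂ i) (inj₂ i′) _ _ p≢q = Q-clique i i′ (p≢q ∘ cong inj₂)

    slotOf : ∀ i → Dec (∃ λ j → g j ≡ i) → Fin (suc s) ⊎ Fin ω
    slotOf i (yes (j , _)) = inj₁ (Fin.inject₁ j)
    slotOf i (no _) = inj₂ i

    slot : Fin (suc ω) → Fin (suc s) ⊎ Fin ω
    slot Fin.zero = inj₁ (Fin.fromℕ s)
    slot (Fin.suc i) = slotOf i (any? λ j → g j ≟ i)

    slotOf-outside : ∀ i d → Outside (slotOf i d)
    slotOf-outside i (yes _) = _
    slotOf-outside i (no ∄j) j gj≡i = ∄j (j , gj≡i)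

    slot-outside : ∀ a → Outside (slot a)
    slot-outside Fin.zero = _
    slot-outside (Fin.suc i) = slotOf-outside i _

    fromℕ-∉-slotOf : ∀ i d → inj₁ (Fin.fromℕ s) ≢ slotOf i d
    fromℕ-∉-slotOf i (yes _) = fromℕ≢inject₁ ∘ inj₁-injective
    fromℕ-∉-slotOf i (no _) ()

    slotOf-injective : ∀ i i′ d d′ → slotOf i d ≡ slotOf i′ d′ → i ≡ i′
    slotOf-injective i i′ (yes (j , gj≡i)) (yes (j′ , gj′≡i′)) eq =
      trans (sym gj≡i) (trans (cong g (inject₁-injective (inj₁-injective eq))) gj′≡i′)
    slotOf-injective i i′ (no _) (no _) eq = inj₂-injective eq
    slotOf-injective i i′ (yes _) (no _) ()
    slotOf-injective i i′ (no _) (yes _) ()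

    slot-injective : ∀ a b → slot a ≡ slot b → a ≡ b
    slot-injective Fin.zero Fin.zero _ = refl
    slot-injective Fin.zero (Fin.suc i) eq = contradiction eq (fromℕ-∉-slotOf i _)
    slot-injective (Fin.suc i) Fin.zero eq = contradiction (sym eq) (fromℕ-∉-slotOf i _)
    slot-injective (Fin.suc i) (Fin.suc i′) eq = cong Fin.suc (slotOf-injective i i′ _ _ eq)

    enlarged-clique : IsClique G (vertex ∘ slot)
    enlarged-clique a b a≢b =
      vertex-adjacent (slot a) (slot b) (slot-outside a) (slot-outside b) (a≢b ∘ slot-injective a b)

    larger-clique : HasClique G ⊤ (suc ω)
    larger-clique = vertex ∘ slot , clique-injective G enlarged-clique , (λ _ → ∈⊤) , enlarged-clique

  seesAllBut-free : ∀ {s} (g : Fin s → Fin ω) → FreeOn (K (suc s)) G (seesAllBut g)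
  seesAllBut-free g copy with copyK⇒clique G copy
  ... | C , _ , C∈ , C-clique =
    ℕ.1+n≰n (ω-max _ (Enlarge.larger-clique g C C-clique (∈-toSubset⁻ (SeesAllBut? g) ∘ C∈)))

  classify : ∀ {s} → Fin ω → ∀ x →
    (∃ λ i → x ≡ Q i) ⊎
    (∃ λ (g : Fin (suc s) → Fin ω) → IsolatedFrom g x) ⊎
    (∃ λ (g : Fin s → Fin ω) → SeesAllBut g x)
  classify {s} default x with any? (λ i → x ≟ Q i)
  ... | yes x∈Q = inj₁ x∈Q
  ... | no x∉Q = inj₂ (Sum.map isolated sees (distinct-or-covered default s nonNeighbours))
    where
    nonNeighbour? : Decidable λ i → adj G x (Q i) ≡ false
    nonNeighbour? i = adj G x (Q i) ≟ᵇ false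

    nonNeighbours : List (Fin ω)
    nonNeighbours = filter nonNeighbour? (allFin ω)

    isolated : (Σ (Fin (suc s) → Fin ω) λ g → Injective g × (∀ j → g j ∈ₗ nonNeighbours)) →
               ∃ λ g → IsolatedFrom g x
    isolated (g , g-inj , g∈) =
      g , g-inj , λ j → (λ x≡ → x∉Q (g j , x≡)) , proj₂ (∈-filter⁻ nonNeighbour? {xs = allFin ω} (g∈ j))

    sees : (Σ (Fin s → Fin ω) λ g → ∀ i → i ∈ₗ nonNeighbours → ∃ λ j → g j ≡ i) →
           ∃ λ g → SeesAllBut g x
    sees (g , g-covers) = g , λ i i-missed → ¬-not λ x≁Qi →
      let (j , gj≡i) = g-covers i (∈-filter⁺ nonNeighbour? (∈-allFin i) x≁Qi) in i-missed j gj≡i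

  covered : ∀ {s} → Fin ω → ∀ x →
    x ∈ ⋃ᶠ (⁅_⁆ ∘ Q) ∪ (⋃ᶠ (isolatedFrom {suc s} ∘ finToFun) ∪ ⋃ᶠ (seesAllBut {s} ∘ finToFun))
  covered {s} default x with classify {s} default x
  ... | inj₁ (i , refl) = x∈p∪q⁺ (inj₁ (∈⋃ᶠ⁺ _ i (x∈⁅x⁆ (Q i))))
  ... | inj₂ (inj₁ (g , x-isolated)) = x∈p∪q⁺ (inj₂ (x∈p∪q⁺ (inj₁ (∈⋃ᶠ⁺ (isolatedFrom {suc s} ∘ finToFun) (funToFin g)
          (∈-toSubset⁺ (IsolatedFrom? _) (isolatedFrom-resp (sym ∘ finToFun-funToFin g) x-isolated))))))
  ... | inj₂ (inj₂ (g , x-sees)) = x∈p∪q⁺ (inj₂ (x∈p∪q⁺ (inj₂ (∈⋃ᶠ⁺ (seesAllBut {s} ∘ finToFun) (funToFin g)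
          (∈-toSubset⁺ (SeesAllBut? _) (seesAllBut-resp (sym ∘ finToFun-funToFin g) x-sees))))))

  module _ {ψ : ℕ → ℕ} (ψ-mono : NonDecreasing ψ) where

    isolatedFrom-candidate : ∀ {t} (g : Fin t → Fin ω) →
                             Isolating (K t) G ψ ⊎ Colourable G (isolatedFrom g) (ψ ω)
    isolatedFrom-candidate g with injective? g
    ... | no ¬g-inj = inj₂ (colourable-∅ G λ (x , x∈) → ¬g-inj (proj₁ (∈-toSubset⁻ (IsolatedFrom? g) x∈)))
    ... | yes g-inj = Sum.map₁ (λ exceeds → isolatedFrom g , exceeds , inj₂ (isolatedFrom-copy g-inj))
                               (chiExceeds-or-colourable G ψ-mono ω-max (isolatedFrom g))

    seesAllBut-candidate : ∀ {s} (g : Fin s → Fin ω) →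
                           Isolating (K (suc s)) G ψ ⊎ Colourable G (seesAllBut g) (ψ ω)
    seesAllBut-candidate g = Sum.map₁ (λ exceeds → seesAllBut g , exceeds , inj₁ (seesAllBut-free g))
                                      (chiExceeds-or-colourable G ψ-mono ω-max (seesAllBut g))

    isolating-or-colourable : ∀ {s} → Fin ω →
      Isolating (K (suc s)) G ψ ⊎ Colourable G ⊤ (ω + (ω ^ suc s * ψ ω + ω ^ s * ψ ω))
    isolating-or-colourable {s} default
      with someLeft-or-allRight (isolatedFrom-candidate {suc s} ∘ finToFun)
         | someLeft-or-allRight (seesAllBut-candidate {s} ∘ finToFun)
    ... | inj₁ isolating | _ = inj₁ isolating
    ... | inj₂ _ | inj₁ isolating = inj₁ isolating
    ... | inj₂ isolatedFrom-colourable | inj₂ seesAllBut-colourable =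
      inj₂ (colourable-⊆ G (λ {x} _ → covered {s} default x)
             (colourable-∪ G clique-colourable
               (colourable-∪ G (colourable-⋃ᶠ G _ isolatedFrom-colourable)
                               (colourable-⋃ᶠ G _ seesAllBut-colourable))))
      where
      clique-colourable : Colourable G (⋃ᶠ (⁅_⁆ ∘ Q)) ω
      clique-colourable =
        colourable-mono G (ℕ.≤-reflexive (ℕ.*-identityʳ ω)) (colourable-⋃ᶠ G _ (colourable-⁅⁆ G ∘ Q))

isolationBound : ℕ → (ℕ → ℕ) → ℕ → ℕ
isolationBound s ψ x = ψ x + (x + (x ^ suc s * ψ x + x ^ s * ψ x))

isolationBound-polynomial : ∀ s {ψ} → IsPolynomial ψ → IsPolynomial (isolationBound s ψ)
isolationBound-polynomial s ψ-poly =
  IsPolynomial-+ ψ-poly (IsPolynomial-+ IsPolynomial-id (IsPolynomial-+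
    (IsPolynomial-* (IsPolynomial-^ (suc s)) ψ-poly) (IsPolynomial-* (IsPolynomial-^ s) ψ-poly)))

isolating : ∀ s {ψ} → NonDecreasing ψ → ∀ G → ChiExceeds G ⊤ (isolationBound s ψ) → Isolating (K (suc s)) G ψ
isolating s {ψ} ψ-mono G χ>φ with cliqueNumber G ⊤
... | ω , ω-number with ω ℕ.<? suc s
... | yes ω<t = ⊤ , chiExceeds-mono G (λ w → ℕ.m≤m+n (ψ w) _) χ>φ ,
                inj₁ λ copy → ℕ.<⇒≱ ω<t (proj₂ ω-number _ (copyK⇒clique G copy))
... | no ω≮t with MaximumClique.isolating-or-colourable G ω-number ψ-mono
                    (Fin.fromℕ< (ℕ.<-≤-trans ℕ.z<s (ℕ.≮⇒≥ ω≮t)))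
... | inj₁ found = found
... | inj₂ colourable = contradiction (colourable-mono G (ℕ.m≤n+m _ (ψ ω)) colourable) (χ>φ ω ω-number)

K₀-anticompleteCopy : ∀ G A → AnticompleteCopy (K 0) G A
K₀-anticompleteCopy G A = ((λ ()) , (λ ()) , (λ ())) , (λ ()) , (λ ())

mainTheorem4 : ∀ (t : ℕ) → SelfIsolating (K t)
mainTheorem4 zero ψ _ ψ-poly = ψ , ψ-poly , λ G χ>ψ → ⊤ , χ>ψ , inj₂ (K₀-anticompleteCopy G ⊤)
mainTheorem4 (suc s) ψ ψ-mono ψ-poly = isolationBound s ψ , isolationBound-polynomial s ψ-poly , isolating s ψ-mono
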